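{- Let $K_{n_1}$ be the complete graph of order $n_1$ and let $H$ be a graph with $n_2$ vertices. Then $$\chi_{\le 2}(K_{n_1}\diamond H)=\begin{cases} n_1(n_2+1) & \text{if } n_1 \text{ is odd},\\ n_1(n_2+1)-n_2 & \text{if } n_1 \text{ is even}.\end{cases}$$
   Context: For a simple graph $G$ with edges $e_1,\dots,e_m$ and a graph $H$, the edge corona product $G\diamond H$ is the graph obtained by taking one copy of $G$ and $m$ vertex-disjoint copies $H_1,\dots,H_m$ of $H$ and joining both end vertices of $e_i$ to every vertex of $H_i$, $1\le i\le m$. A $k$-distance coloring of a graph is a vertex coloring in which any two distinct vertices at distance at most $k$ receive different colors; $\chi_{\le k}$ denotes the minimum number of colors in a $k$-distance coloring. -}

module Defs where

open import Data.Nat using (ℕ; zero; suc; _≤_)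
open import Data.Fin using (Fin; _<_; _≟_)
open import Data.Bool using (Bool; true; false; not)
open import Data.Product using (Σ; Σ-syntax; _×_; _,_; proj₁; proj₂; ∃-syntax)
open import Data.Sum using (_⊎_; inj₁; inj₂)
open import Relation.Binary.PropositionalEquality using (_≡_; refl; sym; _≢_)
open import Relation.Nullary using (Dec; yes; no; ¬_)
open import Relation.Nullary.Decidable using (⌊_⌋)

record SimpleGraph (n : ℕ) : Set where
  field
    adj    : Fin n → Fin n → Bool
    adj-sym   : ∀ u v → adj u v ≡ adj v u
    adj-irrefl : ∀ u → adj u u ≡ false

open SimpleGraph public

record Graph : Set₁ where
  field
    V   : Set
    Adj : V → V → Set

open Graph public

complete : (n : ℕ) → SimpleGraph n
complete n = record { adj = λ u v → not ⌊ u ≟ v ⌋ ; adj-sym = symm ; adj-irrefl = irr }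
  where
    symm : ∀ u v → not ⌊ u ≟ v ⌋ ≡ not ⌊ v ≟ u ⌋
    symm u v with u ≟ v | v ≟ u
    ... | yes _ | yes _ = refl
    ... | no _  | no _  = refl
    ... | yes p | no q  with q (sym p)
    ... | ()
    symm u v | no q | yes p with q (sym p)
    ... | ()
    irr : ∀ u → not ⌊ u ≟ u ⌋ ≡ false
    irr u with u ≟ u
    ... | yes _ = refl
    ... | no q with q refl
    ... | ()

-- Edges e = {u , v} of G, each listed once, oriented so that u < v.
Edge : {n : ℕ} → SimpleGraph n → Set
Edge {n} G = Σ[ u ∈ Fin n ] Σ[ v ∈ Fin n ] (u < v × adj G u v ≡ true)

end₁ : {n : ℕ} {G : SimpleGraph n} → Edge G → Fin n
end₁ (u , _ , _) = u

end₂ : {n : ℕ} {G : SimpleGraph n} → Edge G → Fin n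
end₂ (_ , v , _) = v

-- Vertex set of the edge corona G ◇ H: V(G) ⊎ (copies H_e, e ∈ E(G)).
CoronaV : {n₁ n₂ : ℕ} → SimpleGraph n₁ → SimpleGraph n₂ → Set
CoronaV {n₁} {n₂} G H = Fin n₁ ⊎ (Edge G × Fin n₂)

CoronaAdj : {n₁ n₂ : ℕ} (G : SimpleGraph n₁) (H : SimpleGraph n₂) →
            CoronaV G H → CoronaV G H → Set
CoronaAdj G H (inj₁ u) (inj₁ v) = adj G u v ≡ true
CoronaAdj G H (inj₁ u) (inj₂ (e , x)) = (u ≡ end₁ {G = G} e) ⊎ (u ≡ end₂ {G = G} e)
CoronaAdj G H (inj₂ (e , x)) (inj₁ u) = (u ≡ end₁ {G = G} e) ⊎ (u ≡ end₂ {G = G} e)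
CoronaAdj G H (inj₂ (e , x)) (inj₂ (e′ , y)) = (e ≡ e′) × (adj H x y ≡ true)

_◇_ : {n₁ n₂ : ℕ} → SimpleGraph n₁ → SimpleGraph n₂ → Graph
G ◇ H = record { V = CoronaV G H ; Adj = CoronaAdj G H }

-- Walk of length at most k from u to v; "Reach G k u v" iff d(u,v) ≤ k.
data Reach (G : Graph) : ℕ → V G → V G → Set where
  here : ∀ {k u} → Reach G k u u
  step : ∀ {k u w v} → Adj G u w → Reach G k w v → Reach G (suc k) u v

IsDistColoring : (G : Graph) (k c : ℕ) → (V G → Fin c) → Set
IsDistColoring G k c f =
  ∀ u v → u ≢ v → Reach G k u v → f u ≢ f v

DistChromaticNumber : (G : Graph) (k c : ℕ) → Set
DistChromaticNumber G k c =
  (Σ[ f ∈ (V G → Fin c) ] IsDistColoring G k c f) ×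
  (∀ c′ (f : V G → Fin c′) → IsDistColoring G k c′ f → c ≤ c′)

module Submission where

-- For any graph G with a proper edge colouring κ by N colours, G ◇ H
-- has a 2-distance colouring with n + h·N colours: keep a private colour for each
-- vertex of G and give vertex x of the copy on e the pair (x, κ e).  Kₙ has a
-- proper edge colouring by N colours whenever N is odd and n ≤ N + 1 (the rotation
-- colouring, u + v mod N); take N = n for odd n and N = n − 1 for even n.
--
-- Write n = 1 + m.  In a 2-distance colouring of Kₙ ◇ H the vertices
-- of Kₙ, and the h·m "petals" (copy vertices) on the edges at one centre u, are
-- pairwise within distance 2; this gives n + h·m colours.  For odd n a sharper
-- double count is needed: a petal colour occurring at every centre would pair the
-- centres off by a fixed-point-free involution, impossible for odd n, so each
-- colour occurs at no more than m centres, which yields n + h·n colours.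

open import Defs
open import Data.Nat using (ℕ; zero; suc; s≤s; s≤s⁻¹; _+_; _*_; _∸_; _%_; _≤_; _<_; _<?_; NonZero)
open import Data.Nat.Properties
  using (+-comm; +-suc; +-identityʳ; +-cancelˡ-≡; +-mono-<; +-monoʳ-<; +-monoʳ-≤; m≤m+n;
         *-cancelˡ-≡; *-cancelʳ-≤; ≮⇒≥; ≤-antisym; ≤-trans; ≤-refl; n≤1+n; <-irrefl;
         m+n∸n≡m; m+[n∸m]≡n; m+n∸m≡n; ∸-monoˡ-<; module ≤-Reasoning)
open import Data.Nat.DivMod using (%-pred-≡0; m%n<n; m<n⇒m%n≡m; m≤n⇒[n∸m]%m≡n%m)
open import Data.Nat.Tactic.RingSolver using (solve-∀)
open import Data.Fin using (Fin; zero; suc; toℕ; fromℕ<; punchIn; punchOut) renaming (_<_ to _<ᶠ_)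
import Data.Fin.Properties as Finₚ
open import Data.Fin.Properties
  using (suc-injective; 0≢1+n; punchIn-injective; punchInᵢ≢i; punchIn-punchOut; punchOut-injective;
         +↔⊎; *↔×; injective⇒≤)
open import Data.Bool using (true)
import Data.Bool.Properties as Bool
open import Data.Empty using (⊥; ⊥-elim)
open import Data.Sum using (_⊎_; inj₁; inj₂)
open import Data.Sum.Properties using (inj₁-injective; inj₂-injective)
open import Data.Sum.Function.Propositional using (_⊎-↔_)
open import Data.Product using (Σ; _×_; _,_; proj₁; proj₂)
open import Data.Product.Properties using (,-injectiveˡ; ,-injectiveʳ; ≡-dec)
open import Data.Product.Function.NonDependent.Propositional using (_×-↔_)
open import Function using (_∘_; _↔_; Injective; mk↣)
open import Function.Bundles using (module Inverse; module Injection)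
open import Function.Properties.Inverse using (↔-refl; ↔-sym; ↔-trans; ↔⇒↣)
open import Function.Properties.Injection using (↣-trans)
open import Relation.Nullary using (¬_; Dec; yes; no; ¬?)
open import Relation.Nullary.Decidable using (decidable-stable)
open import Relation.Binary.Definitions using (DecidableEquality; tri<; tri≈; tri>)
open import Relation.Binary.PropositionalEquality
  using (_≡_; _≢_; refl; sym; trans; cong; cong₂; subst; subst₂; module ≡-Reasoning)
open import Axiom.UniquenessOfIdentityProofs using (module Decidable⇒UIP)

Odd : ℕ → Set
Odd N = N % 2 ≡ 1

%2-+-double : ∀ x t → (x + (t + t)) % 2 ≡ x % 2
%2-+-double x zero rewrite +-identityʳ x = refl
%2-+-double x (suc t) rewrite +-suc t t | +-suc x (suc (t + t)) | +-suc x (t + t) = %2-+-double x t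

odd-not-even : ∀ n → Odd n → n % 2 ≢ 0
odd-not-even _ odd even with () ← trans (sym odd) even

double-not-odd : ∀ t → ¬ Odd (t + t)
double-not-odd t odd = odd-not-even (t + t) odd (%2-+-double 0 t)

double-injective : ∀ {a b} → a + a ≡ b + b → a ≡ b
double-injective {a} {b} eq = *-cancelˡ-≡ a b 2 (begin
  a + (a + 0) ≡⟨ cong (a +_) (+-identityʳ a) ⟩
  a + a       ≡⟨ eq ⟩
  b + b       ≡⟨ cong (b +_) (sym (+-identityʳ b)) ⟩
  b + (b + 0) ∎)
  where open ≡-Reasoning

module Modular (N : ℕ) .{{_ : NonZero N}} where

  %-below-2N : ∀ s → s < N + N → s ≡ s % N ⊎ s ≡ N + s % N
  %-below-2N s s<2N with s <? N
  ... | yes s<N = inj₁ (sym (m<n⇒m%n≡m s<N))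
  ... | no s≮N = inj₂ (begin
    s                ≡⟨ sym (m+[n∸m]≡n N≤s) ⟩
    N + (s ∸ N)      ≡⟨ cong (N +_) (sym (m<n⇒m%n≡m s∸N<N)) ⟩
    N + (s ∸ N) % N  ≡⟨ cong (N +_) (m≤n⇒[n∸m]%m≡n%m N≤s) ⟩
    N + s % N        ∎)
    where
    open ≡-Reasoning
    N≤s : N ≤ s
    N≤s = ≮⇒≥ s≮N
    s∸N<N : s ∸ N < N
    s∸N<N = subst (s ∸ N <_) (m+n∸m≡n N N) (∸-monoˡ-< s<2N N≤s)

  %-congruent-below-2N : ∀ {s t} → s < N + N → t < N + N → s % N ≡ t % N →
                         s ≡ t ⊎ s ≡ N + t ⊎ t ≡ N + s
  %-congruent-below-2N {s} {t} s< t< eq with %-below-2N s s< | %-below-2N t t<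
  ... | inj₁ s≡ | inj₁ t≡ = inj₁ (trans s≡ (trans eq (sym t≡)))
  ... | inj₁ s≡ | inj₂ t≡ = inj₂ (inj₂ (trans t≡ (cong (N +_) (trans (sym eq) (sym s≡)))))
  ... | inj₂ s≡ | inj₁ t≡ = inj₂ (inj₁ (trans s≡ (cong (N +_) (trans eq (sym t≡)))))
  ... | inj₂ s≡ | inj₂ t≡ = inj₁ (trans s≡ (trans (cong (N +_) eq) (sym t≡)))

  no-wrap : ∀ {a b} c → a < N → c + a ≢ N + (c + b)
  no-wrap {a} {b} c a<N eq = <-irrefl eq (begin-strict
    c + a        <⟨ +-monoʳ-< c a<N ⟩
    c + N        ≡⟨ +-comm c N ⟩
    N + c        ≤⟨ +-monoʳ-≤ N (m≤m+n c b) ⟩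
    N + (c + b)  ∎)
    where open ≤-Reasoning

  +-cancelˡ-% : ∀ {c a b} → c < N → a < N → b < N → (c + a) % N ≡ (c + b) % N → a ≡ b
  +-cancelˡ-% {c} {a} {b} c<N a<N b<N eq
    with %-congruent-below-2N (+-mono-< c<N a<N) (+-mono-< c<N b<N) eq
  ... | inj₁ ca≡cb = +-cancelˡ-≡ c a b ca≡cb
  ... | inj₂ (inj₁ wrap) = ⊥-elim (no-wrap c a<N wrap)
  ... | inj₂ (inj₂ wrap) = ⊥-elim (no-wrap c b<N wrap)

  -- For odd N, a + a and b + b cannot differ by N: the difference of two doubles is even.
  no-double-wrap : Odd N → ∀ {a b} → a + a ≢ N + (b + b)
  no-double-wrap odd {a} {b} wrap =
    double-not-odd a (trans (cong (_% 2) wrap) (trans (%2-+-double N b) odd))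

  double-cancel-% : Odd N → ∀ {a b} → a < N → b < N → (a + a) % N ≡ (b + b) % N → a ≡ b
  double-cancel-% odd {a} {b} a<N b<N eq
    with %-congruent-below-2N (+-mono-< a<N a<N) (+-mono-< b<N b<N) eq
  ... | inj₁ aa≡bb = double-injective aa≡bb
  ... | inj₂ (inj₁ wrap) = ⊥-elim (no-double-wrap odd {a} {b} wrap)
  ... | inj₂ (inj₂ wrap) = ⊥-elim (no-double-wrap odd {b} {a} wrap)

-- The classical edge colouring of K_{N+1}, N odd, by N colours: an edge {u, v}
-- with u, v < N gets u + v mod N, and the edge from u < N to the apex N gets
-- 2u mod N.  pairSum is the number reduced modulo N.
module Rotation (N : ℕ) .{{_ : NonZero N}} (odd : Odd N) where
  open Modular N

  apex : ∀ {u} → u ≤ N → ¬ u < N → u ≡ N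
  apex u≤N u≮N = ≤-antisym u≤N (≮⇒≥ u≮N)

  pairSum : ℕ → ℕ → ℕ
  pairSum u v with u <? N | v <? N
  ... | yes _ | yes _ = u + v
  ... | yes _ | no _  = u + u
  ... | no _  | _     = v + v

  pairSum-sym : ∀ {u v} → u ≤ N → v ≤ N → pairSum u v ≡ pairSum v u
  pairSum-sym {u} {v} u≤N v≤N with u <? N | v <? N
  ... | yes _ | yes _ = +-comm u v
  ... | yes _ | no _  = refl
  ... | no _  | yes _ = refl
  ... | no u≮N | no v≮N = cong (λ z → z + z) (trans (apex v≤N v≮N) (sym (apex u≤N u≮N)))

  pairSum-local : ∀ {w v v'} → w ≤ N → v ≤ N → v' ≤ N → v ≢ w → v' ≢ w →
                  pairSum w v % N ≡ pairSum w v' % N → v ≡ v'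
  pairSum-local {w} {v} {v'} w≤N v≤N v'≤N v≢w v'≢w eq with w <? N | v <? N | v' <? N
  ... | yes w<N | yes v<N | yes v'<N = +-cancelˡ-% w<N v<N v'<N eq
  ... | yes w<N | yes v<N | no _     = ⊥-elim (v≢w (+-cancelˡ-% w<N v<N w<N eq))
  ... | yes w<N | no _    | yes v'<N = ⊥-elim (v'≢w (+-cancelˡ-% w<N v'<N w<N (sym eq)))
  ... | yes _   | no v≮N  | no v'≮N  = trans (apex v≤N v≮N) (sym (apex v'≤N v'≮N))
  ... | no _    | yes v<N | yes v'<N = double-cancel-% odd v<N v'<N eq
  ... | no w≮N  | no v≮N  | _        = ⊥-elim (v≢w (trans (apex v≤N v≮N) (sym (apex w≤N w≮N))))
  ... | no w≮N  | yes _   | no v'≮N  = ⊥-elim (v'≢w (trans (apex v'≤N v'≮N) (sym (apex w≤N w≮N))))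

-- Removing the 2-cycle {0, σ 0} from a fixed-point-free involution σ of Fin (2 + k)
-- leaves a fixed-point-free involution of the remaining k points.
module RemoveTwoCycle {k : ℕ} (σ : Fin (suc (suc k)) → Fin (suc (suc k)))
                      (involutive : ∀ i → σ (σ i) ≡ i) (no-fixed-point : ∀ i → σ i ≢ i)
                      (a : Fin (suc k)) (σ0≡ : σ zero ≡ suc a) where

  σ-injective : ∀ {i j} → σ i ≡ σ j → i ≡ j
  σ-injective {i} {j} eq = trans (sym (involutive i)) (trans (cong σ eq) (involutive j))

  -- The remaining points, i.e. the complement of {0, suc a}.
  embed : Fin k → Fin (suc (suc k))
  embed i = suc (punchIn a i)

  σ-embed-≢0 : ∀ i → zero ≢ σ (embed i)
  σ-embed-≢0 i eq = punchInᵢ≢i a i (suc-injective (begin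
    embed i              ≡⟨ sym (involutive (embed i)) ⟩
    σ (σ (embed i))      ≡⟨ cong σ (sym eq) ⟩
    σ zero               ≡⟨ σ0≡ ⟩
    suc a                ∎))
    where open ≡-Reasoning

  σ-embed-pred : Fin k → Fin (suc k)
  σ-embed-pred i = punchOut (σ-embed-≢0 i)

  σ-embed-pred-≢a : ∀ i → a ≢ σ-embed-pred i
  σ-embed-pred-≢a i eq = 0≢1+n (σ-injective (begin
    σ zero                  ≡⟨ σ0≡ ⟩
    suc a                   ≡⟨ cong suc eq ⟩
    suc (σ-embed-pred i)    ≡⟨ punchIn-punchOut (σ-embed-≢0 i) ⟩
    σ (embed i)             ∎))
    where open ≡-Reasoning

  -- σ conjugated back to Fin k along embed.
  restrict : Fin k → Fin k
  restrict i = punchOut (σ-embed-pred-≢a i)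

  embed-restrict : ∀ i → embed (restrict i) ≡ σ (embed i)
  embed-restrict i = trans (cong suc (punchIn-punchOut (σ-embed-pred-≢a i))) (punchIn-punchOut (σ-embed-≢0 i))

  restrict-involutive : ∀ i → restrict (restrict i) ≡ i
  restrict-involutive i = punchIn-injective a _ _ (suc-injective (begin
    embed (restrict (restrict i))  ≡⟨ embed-restrict (restrict i) ⟩
    σ (embed (restrict i))         ≡⟨ cong σ (embed-restrict i) ⟩
    σ (σ (embed i))                ≡⟨ involutive (embed i) ⟩
    embed i                        ∎))
    where open ≡-Reasoning

  restrict-no-fixed-point : ∀ i → restrict i ≢ i
  restrict-no-fixed-point i eq = no-fixed-point (embed i) (trans (sym (embed-restrict i)) (cong embed eq))

involution⇒even : ∀ n (σ : Fin n → Fin n) → (∀ i → σ (σ i) ≡ i) → (∀ i → σ i ≢ i) → n % 2 ≡ 0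
involution⇒even zero σ involutive no-fixed-point = refl
involution⇒even (suc zero) σ involutive no-fixed-point = ⊥-elim (no-fixed-point zero (lone (σ zero)))
  where
  lone : (i : Fin 1) → i ≡ zero
  lone zero = refl
involution⇒even (suc (suc k)) σ involutive no-fixed-point with σ zero in σ0≡
... | zero = ⊥-elim (no-fixed-point zero σ0≡)
... | suc a = involution⇒even k restrict restrict-involutive restrict-no-fixed-point
  where open RemoveTwoCycle σ involutive no-fixed-point a σ0≡

card-≤ : ∀ {a b} {A B : Set} → Fin a ↔ A → Fin b ↔ B → (g : A → B) → Injective _≡_ _≡_ g → a ≤ b
card-≤ A↔ B↔ g g-injective = injective⇒≤ (Injection.injective (↣-trans (↔⇒↣ A↔) (↣-trans (mk↣ g-injective) (↔⇒↣ (↔-sym B↔)))))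

-- Both colour counts have the shape a + b·c: vertices of Kₙ plus pairs
-- (vertex of H, colour class).
Fin-+* : ∀ {a b c} → Fin (a + b * c) ↔ (Fin a ⊎ (Fin b × Fin c))
Fin-+* {a} {b} {c} = ↔-trans (+↔⊎ {a} {b * c}) (↔-refl ⊎-↔ *↔× {b} {c})

Separates : (Γ : Graph) (k : ℕ) {C : Set} → (V Γ → C) → Set
Separates Γ k f = ∀ u v → u ≢ v → Reach Γ k u v → f u ≢ f v

separates-∘ : ∀ {Γ k} {C D : Set} {f : V Γ → C} (g : C → D) → Injective _≡_ _≡_ g →
              Separates Γ k f → Separates Γ k (g ∘ f)
separates-∘ g g-injective sep u v u≢v r = sep u v u≢v r ∘ g-injective

reach₂-cases : ∀ {Γ p q} → Reach Γ 2 p q → p ≡ q ⊎ Adj Γ p q ⊎ Σ (V Γ) λ w → Adj Γ p w × Adj Γ w q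
reach₂-cases here = inj₁ refl
reach₂-cases (step p~q here) = inj₂ (inj₁ p~q)
reach₂-cases (step p~w (step w~q here)) = inj₂ (inj₂ (_ , p~w , w~q))

module Edges {n : ℕ} (G : SimpleGraph n) where

  -- The ends of an edge (G is not inferable from an edge, hence this local notation).
  first second : Edge G → Fin n
  first = end₁ {G = G}
  second = end₂ {G = G}

  ends-ordered : (e : Edge G) → first e <ᶠ second e
  ends-ordered (_ , _ , u<v , _) = u<v

  -- An edge is determined by its ends: the remaining data are proofs of propositions.
  edge-ext : (e e' : Edge G) → first e ≡ first e' → second e ≡ second e' → e ≡ e'
  edge-ext (u , v , u<v , uv) (.u , .v , u<v' , uv') refl refl =
    cong₂ (λ lt adjacent → u , v , lt , adjacent) (Finₚ.<-irrelevant u<v u<v') (Bool-UIP uv uv')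
    where open Decidable⇒UIP Bool._≟_ renaming (≡-irrelevant to Bool-UIP)

  -- w is an end of e; this is exactly adjacency between w and the copy of H on e.
  Incident : Fin n → Edge G → Set
  Incident w e = w ≡ first e ⊎ w ≡ second e

  opposite : ∀ {w} e → Incident w e → Fin n
  opposite e (inj₁ _) = second e
  opposite e (inj₂ _) = first e

  opposite-≢ : ∀ {w} e (i : Incident w e) → opposite e i ≢ w
  opposite-≢ e (inj₁ w≡) opp≡ = Finₚ.<-irrefl (trans (sym w≡) (sym opp≡)) (ends-ordered e)
  opposite-≢ e (inj₂ w≡) opp≡ = Finₚ.<-irrefl (trans opp≡ w≡) (ends-ordered e)

  crossed : ∀ e e' → first e ≡ second e' → second e ≡ first e' → ⊥
  crossed e e' p q = Finₚ.<-asym (ends-ordered e) (subst₂ _<ᶠ_ (sym q) (sym p) (ends-ordered e'))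

  opposite-unique : ∀ {w e e'} → e ≡ e' → (i : Incident w e) (i' : Incident w e') →
                    opposite e i ≡ opposite e' i'
  opposite-unique refl (inj₁ _) (inj₁ _) = refl
  opposite-unique refl (inj₂ _) (inj₂ _) = refl
  opposite-unique {e = e} refl (inj₁ w≡) (inj₂ w≡') = ⊥-elim (Finₚ.<-irrefl (trans (sym w≡) w≡') (ends-ordered e))
  opposite-unique {e = e} refl (inj₂ w≡) (inj₁ w≡') = ⊥-elim (Finₚ.<-irrefl (trans (sym w≡') w≡) (ends-ordered e))

  edge-by-opposite : ∀ {w} e e' (i : Incident w e) (i' : Incident w e') → opposite e i ≡ opposite e' i' → e ≡ e'
  edge-by-opposite e e' (inj₁ w≡) (inj₁ w≡') opp≡ = edge-ext e e' (trans (sym w≡) w≡') opp≡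
  edge-by-opposite e e' (inj₂ w≡) (inj₂ w≡') opp≡ = edge-ext e e' opp≡ (trans (sym w≡) w≡')
  edge-by-opposite e e' (inj₁ w≡) (inj₂ w≡') opp≡ = ⊥-elim (crossed e e' (trans (sym w≡) w≡') opp≡)
  edge-by-opposite e e' (inj₂ w≡) (inj₁ w≡') opp≡ = ⊥-elim (crossed e' e (trans (sym w≡') w≡) (sym opp≡))

  ProperEdgeColouring : {C : Set} → (Edge G → C) → Set
  ProperEdgeColouring κ = ∀ w e e' → Incident w e → Incident w e' → κ e ≡ κ e' → e ≡ e'

  pairColouring-proper : {C : Set} (c : Fin n → Fin n → C) → (∀ u v → c u v ≡ c v u) →
                         (∀ w v v' → v ≢ w → v' ≢ w → c w v ≡ c w v' → v ≡ v') →
                         ProperEdgeColouring (λ e → c (first e) (second e))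
  pairColouring-proper c c-sym c-local w e e' i i' eq =
    edge-by-opposite e e' i i'
      (c-local w _ _ (opposite-≢ e i) (opposite-≢ e' i') (trans (sym (seen-from e i)) (trans eq (seen-from e' i'))))
    where
    seen-from : ∀ e (i : Incident w e) → c (first e) (second e) ≡ c w (opposite e i)
    seen-from e (inj₁ w≡) = cong (λ z → c z (second e)) (sym w≡)
    seen-from e (inj₂ w≡) = trans (c-sym (first e) (second e)) (cong (λ z → c z (first e)) (sym w≡))

complete-adj : ∀ {n} (u v : Fin n) → u ≢ v → adj (complete n) u v ≡ true
complete-adj u v u≢v with u Finₚ.≟ v
... | yes u≡v = ⊥-elim (u≢v u≡v)
... | no _ = refl

module CompleteEdges (n : ℕ) where
  open Edges (complete n)

  edgeBetween : (u v : Fin n) → u ≢ v → Edge (complete n)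
  edgeBetween u v u≢v with Finₚ.<-cmp u v
  ... | tri< u<v _ _ = u , v , u<v , complete-adj u v u≢v
  ... | tri≈ _ u≡v _ = ⊥-elim (u≢v u≡v)
  ... | tri> _ _ v<u = v , u , v<u , complete-adj v u (u≢v ∘ sym)

  edgeBetween-from : ∀ u v u≢v → Σ (Incident u (edgeBetween u v u≢v)) λ i → opposite (edgeBetween u v u≢v) i ≡ v
  edgeBetween-from u v u≢v with Finₚ.<-cmp u v
  ... | tri< _ _ _ = inj₁ refl , refl
  ... | tri≈ _ u≡v _ = ⊥-elim (u≢v u≡v)
  ... | tri> _ _ _ = inj₂ refl , refl

  edgeBetween-to : ∀ u v u≢v → Σ (Incident v (edgeBetween u v u≢v)) λ i → opposite (edgeBetween u v u≢v) i ≡ u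
  edgeBetween-to u v u≢v with Finₚ.<-cmp u v
  ... | tri< _ _ _ = inj₂ refl , refl
  ... | tri≈ _ u≡v _ = ⊥-elim (u≢v u≡v)
  ... | tri> _ _ _ = inj₁ refl , refl

completeEdgeColouring : ∀ N .{{_ : NonZero N}} → Odd N → ∀ {n} → n ≤ suc N →
                        Σ (Edge (complete n) → Fin N) (Edges.ProperEdgeColouring (complete n))
completeEdgeColouring N odd {n} n≤1+N =
  _ , pairColouring-proper rotationColour rotationColour-sym rotationColour-local
  where
  open Rotation N odd
  open Edges (complete n)

  vertex-≤ : (u : Fin n) → toℕ u ≤ N
  vertex-≤ u = s≤s⁻¹ (≤-trans (Finₚ.toℕ<n u) n≤1+N)

  rotationColour : Fin n → Fin n → Fin N
  rotationColour u v = fromℕ< (m%n<n (pairSum (toℕ u) (toℕ v)) N)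

  toℕ-rotationColour : ∀ u v → toℕ (rotationColour u v) ≡ pairSum (toℕ u) (toℕ v) % N
  toℕ-rotationColour u v = Finₚ.toℕ-fromℕ< _

  rotationColour-sym : ∀ u v → rotationColour u v ≡ rotationColour v u
  rotationColour-sym u v = Finₚ.toℕ-injective (begin
    toℕ (rotationColour u v)     ≡⟨ toℕ-rotationColour u v ⟩
    pairSum (toℕ u) (toℕ v) % N  ≡⟨ cong (_% N) (pairSum-sym (vertex-≤ u) (vertex-≤ v)) ⟩
    pairSum (toℕ v) (toℕ u) % N  ≡⟨ sym (toℕ-rotationColour v u) ⟩
    toℕ (rotationColour v u)     ∎)
    where open ≡-Reasoning

  rotationColour-local : ∀ w v v' → v ≢ w → v' ≢ w → rotationColour w v ≡ rotationColour w v' → v ≡ v'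
  rotationColour-local w v v' v≢w v'≢w eq = Finₚ.toℕ-injective
    (pairSum-local (vertex-≤ w) (vertex-≤ v) (vertex-≤ v') (v≢w ∘ Finₚ.toℕ-injective) (v'≢w ∘ Finₚ.toℕ-injective)
      (trans (sym (toℕ-rotationColour w v)) (trans (cong toℕ eq) (toℕ-rotationColour w v'))))

module CoronaUpperBound {n h N : ℕ} (G : SimpleGraph n) (H : SimpleGraph h)
                        (κ : Edge G → Fin N) (proper : Edges.ProperEdgeColouring G κ) where

  cornerColour : V (G ◇ H) → Fin n ⊎ (Fin h × Fin N)
  cornerColour (inj₁ u) = inj₁ u
  cornerColour (inj₂ (e , x)) = inj₂ (x , κ e)

  same-copy : ∀ {e x e' y} → Reach (G ◇ H) 2 (inj₂ (e , x)) (inj₂ (e' , y)) → κ e ≡ κ e' → e ≡ e'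
  same-copy r κ≡ with reach₂-cases r
  ... | inj₁ refl = refl
  ... | inj₂ (inj₁ (e≡e' , _)) = e≡e'
  ... | inj₂ (inj₂ (inj₁ w , w∈e , w∈e')) = proper w _ _ w∈e w∈e' κ≡
  ... | inj₂ (inj₂ (inj₂ (_ , _) , (e≡e'' , _) , (e''≡e' , _))) = trans e≡e'' e''≡e'

  cornerColour-separates : Separates (G ◇ H) 2 cornerColour
  cornerColour-separates (inj₁ u) (inj₁ v) u≢v _ eq = u≢v (cong inj₁ (inj₁-injective eq))
  cornerColour-separates (inj₁ _) (inj₂ _) _ _ ()
  cornerColour-separates (inj₂ _) (inj₁ _) _ _ ()
  cornerColour-separates (inj₂ (e , x)) (inj₂ (e' , y)) p≢q r eq
    with refl ← ,-injectiveˡ (inj₂-injective eq)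
    with refl ← same-copy r (,-injectiveʳ (inj₂-injective eq)) = p≢q refl

  distColouring : Σ (V (G ◇ H) → Fin (n + h * N)) (IsDistColoring (G ◇ H) 2 (n + h * N))
  distColouring = _ , separates-∘ (Inverse.from Fin-+*) (Injection.injective (↔⇒↣ (↔-sym Fin-+*))) cornerColour-separates

module CompleteCoronaLowerBound {m h c : ℕ} (H : SimpleGraph h)
                                (f : V (complete (suc m) ◇ H) → Fin c)
                                (sep : Separates (complete (suc m) ◇ H) 2 f) where
  K : SimpleGraph (suc m)
  K = complete (suc m)
  Γ : Graph
  Γ = K ◇ H
  open Edges K
  open CompleteEdges (suc m)

  one-step : ∀ {p q} → Adj Γ p q → Reach Γ 2 p q
  one-step p~q = step p~q here

  two-steps : ∀ {p w q} → Adj Γ p w → Adj Γ w q → Reach Γ 2 p q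
  two-steps p~w w~q = step p~w (step w~q here)

  -- A family of vertices, pairwise distinct and within distance 2, gets distinct
  -- colours (decidability of the index turns "not distinct" into "equal").
  clique-injective : {I : Set} → DecidableEquality I → (g : I → V Γ) →
                     (∀ {i j} → i ≢ j → g i ≢ g j) → (∀ {i j} → i ≢ j → Reach Γ 2 (g i) (g j)) →
                     ∀ {i j} → f (g i) ≡ f (g j) → i ≡ j
  clique-injective _≟_ g g-distinct g-near {i} {j} eq with i ≟ j
  ... | yes i≡j = i≡j
  ... | no i≢j = ⊥-elim (sep (g i) (g j) (g-distinct i≢j) (g-near i≢j) eq)

  centre-injective : ∀ {u v} → f (inj₁ u) ≡ f (inj₁ v) → u ≡ v
  centre-injective = clique-injective Finₚ._≟_ inj₁ (λ u≢v → u≢v ∘ inj₁-injective)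
                       (λ {u} {v} u≢v → one-step (complete-adj u v u≢v))

  centre-≢-copy : ∀ u e x → f (inj₁ u) ≢ f (inj₂ (e , x))
  centre-≢-copy u e x with u Finₚ.≟ first e
  ... | yes u≡ = sep (inj₁ u) (inj₂ (e , x)) (λ ()) (one-step (inj₁ u≡))
  ... | no u≢ = sep (inj₁ u) (inj₂ (e , x)) (λ ()) (two-steps {w = inj₁ (first e)} (complete-adj u _ u≢) (inj₁ refl))

  -- The j-th edge at u joins u to punchIn u j; its copy vertices are the petals at u.
  spoke : Fin (suc m) → Fin m → Edge K
  spoke u j = edgeBetween u (punchIn u j) (punchInᵢ≢i u j ∘ sym)

  centre : ∀ u j → Incident u (spoke u j)
  centre u j = proj₁ (edgeBetween-from u (punchIn u j) _)

  tip : ∀ u j → Incident (punchIn u j) (spoke u j)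
  tip u j = proj₁ (edgeBetween-to u (punchIn u j) _)

  petal : Fin (suc m) → Fin m → Fin h → V Γ
  petal u j x = inj₂ (spoke u j , x)

  spoke-injective : ∀ u {j j'} → spoke u j ≡ spoke u j' → j ≡ j'
  spoke-injective u {j} {j'} eq = punchIn-injective u j j' (begin
    punchIn u j                         ≡⟨ sym (proj₂ (edgeBetween-from u (punchIn u j) _)) ⟩
    opposite (spoke u j) (centre u j)   ≡⟨ opposite-unique eq (centre u j) (centre u j') ⟩
    opposite (spoke u j') (centre u j') ≡⟨ proj₂ (edgeBetween-from u (punchIn u j') _) ⟩
    punchIn u j'                        ∎)
    where open ≡-Reasoning

  -- The petals at a fixed centre u are pairwise within distance 2 (through u).
  petal-injective : ∀ u {j x j' x'} → f (petal u j x) ≡ f (petal u j' x') → (j , x) ≡ (j' , x')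
  petal-injective u = clique-injective (≡-dec Finₚ._≟_ Finₚ._≟_) (λ (j , x) → petal u j x)
                        (λ jx≢ eq → jx≢ (cong₂ _,_ (spoke-injective u (cong proj₁ (inj₂-injective eq))) (cong proj₂ (inj₂-injective eq))))
                        (λ {(j , _)} {(j' , _)} _ → two-steps {w = inj₁ u} (centre u j) (centre u j'))

  centres-and-petals : Fin (suc m) ⊎ (Fin h × Fin m) → Fin c
  centres-and-petals (inj₁ u) = f (inj₁ u)
  centres-and-petals (inj₂ (x , j)) = f (petal zero j x)

  centres-and-petals-injective : Injective _≡_ _≡_ centres-and-petals
  centres-and-petals-injective {inj₁ u} {inj₁ v} eq = cong inj₁ (centre-injective eq)
  centres-and-petals-injective {inj₁ u} {inj₂ (x , j)} eq = ⊥-elim (centre-≢-copy u _ x eq)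
  centres-and-petals-injective {inj₂ (x , j)} {inj₁ u} eq = ⊥-elim (centre-≢-copy u _ x (sym eq))
  centres-and-petals-injective {inj₂ (x , j)} {inj₂ (x' , j')} eq
    with refl ← petal-injective zero eq = refl

  lower-bound : suc m + h * m ≤ c
  lower-bound = card-≤ Fin-+* ↔-refl centres-and-petals centres-and-petals-injective

  -- Colour col appears on a petal at centre u.  Distinct petals at u have distinct
  -- colours, so this happens at most once per centre.
  Occupies : Fin c → Fin (suc m) → Set
  Occupies col u = Σ (Fin m) λ j → Σ (Fin h) λ x → f (petal u j x) ≡ col

  occupies? : ∀ col u → Dec (Occupies col u)
  occupies? col u = Finₚ.any? λ j → Finₚ.any? λ x → f (petal u j x) Finₚ.≟ col

  -- If col occupies every centre, the centres are paired off: u is matched with the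
  -- far end of the spoke whose copy carries col.  Two petals of colour col on
  -- different spokes at a common vertex would be at distance 2.
  module Partner (col : Fin c) (everywhere : ∀ u → Occupies col u) where
    partner : Fin (suc m) → Fin (suc m)
    partner u = punchIn u (proj₁ (everywhere u))

    partner-≢ : ∀ u → partner u ≢ u
    partner-≢ u = punchInᵢ≢i u _

    partner-involutive : ∀ u → partner (partner u) ≡ u
    partner-involutive u with partner (partner u) Finₚ.≟ u
    ... | yes back = back
    ... | no astray = ⊥-elim (sep p q p≢q (two-steps {w = inj₁ w} (tip u j) (centre w j₂)) (trans p-col (sym q-col)))
      where
      w : Fin (suc m)
      w = partner u
      j j₂ : Fin m
      j = proj₁ (everywhere u)
      j₂ = proj₁ (everywhere w)
      x x₂ : Fin h
      x = proj₁ (proj₂ (everywhere u))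
      x₂ = proj₁ (proj₂ (everywhere w))
      p q : V Γ
      p = petal u j x
      q = petal w j₂ x₂
      p-col : f p ≡ col
      p-col = proj₂ (proj₂ (everywhere u))
      q-col : f q ≡ col
      q-col = proj₂ (proj₂ (everywhere w))
      -- Seen from w, the spoke of p ends at u and the spoke of q at partner w.
      p≢q : p ≢ q
      p≢q eq = astray (begin
        partner w                            ≡⟨ sym (proj₂ (edgeBetween-from w (partner w) _)) ⟩
        opposite (spoke w j₂) (centre w j₂)  ≡⟨ opposite-unique (sym (cong proj₁ (inj₂-injective eq))) (centre w j₂) (tip u j) ⟩
        opposite (spoke u j) (tip u j)       ≡⟨ proj₂ (edgeBetween-to u w _) ⟩
        u                                    ∎)
        where open ≡-Reasoning

  -- For odd n every colour misses some centre, since Fin n has no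
  -- fixed-point-free involution.
  hole : Odd (suc m) → (col : Fin c) → Σ (Fin (suc m)) λ z → ¬ Occupies col z
  hole odd col with Finₚ.any? (λ u → ¬? (occupies? col u))
  ... | yes found = found
  ... | no none = ⊥-elim (odd-not-even (suc m) odd (involution⇒even (suc m) partner partner-involutive partner-≢))
    where
    open Partner col (λ u → decidable-stable (occupies? col u) (λ ¬occ → none (u , ¬occ)))

  -- Each colour col occupies at most m centres, so those
  -- centres can be numbered by Fin m (skipping the hole of col).  Sending a petal to
  -- its colour and the number of its centre, and a pair (u, t) to (f u, t), is
  -- injective; hence (n + h·n)·m ≤ c·m.
  module OddCount (odd : Odd (suc m)) where
    away-from-hole : ∀ {col} u → Occupies col u → proj₁ (hole odd col) ≢ u
    away-from-hole {col} u o z≡u = proj₂ (hole odd col) (subst (Occupies col) (sym z≡u) o)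

    slot : ∀ {col} u → Occupies col u → Fin m
    slot u o = punchOut (away-from-hole u o)

    slot-injective : ∀ {col col'} u u' (o : Occupies col u) (o' : Occupies col' u') →
                     col ≡ col' → slot u o ≡ slot u' o' → u ≡ u'
    slot-injective u u' o o' refl = punchOut-injective (away-from-hole u o) (away-from-hole u' o')

    count : (Fin (suc m) ⊎ (Fin h × Fin (suc m))) × Fin m → Fin c × Fin m
    count (inj₁ u , t) = f (inj₁ u) , t
    count (inj₂ (x , u) , j) = f (petal u j x) , slot u (j , x , refl)

    count-injective : Injective _≡_ _≡_ count
    count-injective {inj₁ u , t} {inj₁ v , t'} eq
      with refl ← centre-injective (,-injectiveˡ eq) = cong (inj₁ u ,_) (,-injectiveʳ eq)
    count-injective {inj₁ u , _} {inj₂ (x , _) , _} eq = ⊥-elim (centre-≢-copy u _ x (,-injectiveˡ eq))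
    count-injective {inj₂ (x , _) , _} {inj₁ u , _} eq = ⊥-elim (centre-≢-copy u _ x (sym (,-injectiveˡ eq)))
    count-injective {inj₂ (x , u) , j} {inj₂ (x' , u') , j'} eq
      with refl ← slot-injective u u' (j , x , refl) (j' , x' , refl) (,-injectiveˡ eq) (,-injectiveʳ eq)
      with refl ← petal-injective u (,-injectiveˡ eq) = refl

    odd-lower-bound : (suc m + h * suc m) * m ≤ c * m
    odd-lower-bound = card-≤ (↔-trans *↔× (Fin-+* ×-↔ ↔-refl)) *↔× count count-injective

odd-count : ∀ n h → n * (h + 1) ≡ n + h * n
odd-count = solve-∀

even-count : ∀ m h → suc m * (h + 1) ∸ h ≡ suc m + h * m
even-count m h = trans (cong (_∸ h) (expand m h)) (m+n∸n≡m (suc m + h * m) h)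
  where
  expand : ∀ m h → suc m * (h + 1) ≡ (suc m + h * m) + h
  expand = solve-∀

mainTheorem5 : (n₁ n₂ : ℕ) → 2 ≤ n₁ → (H : SimpleGraph n₂) →
    ((n₁ % 2 ≡ 1 → DistChromaticNumber (complete n₁ ◇ H) 2 (n₁ * (n₂ + 1))) ×
     (n₁ % 2 ≡ 0 → DistChromaticNumber (complete n₁ ◇ H) 2 (n₁ * (n₂ + 1) ∸ n₂)))
mainTheorem5 .(suc (suc k)) h (s≤s (s≤s {n = k} _)) H = odd-case , even-case
  where
  m n : ℕ
  m = suc k
  n = suc m

  odd-case : n % 2 ≡ 1 → DistChromaticNumber (complete n ◇ H) 2 (n * (h + 1))
  odd-case odd = subst (DistChromaticNumber (complete n ◇ H) 2) (sym (odd-count n h))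
    (CoronaUpperBound.distColouring (complete n) H κ proper ,
     λ c f sep → *-cancelʳ-≤ (n + h * n) c m (CompleteCoronaLowerBound.OddCount.odd-lower-bound H f sep odd))
    where open Σ (completeEdgeColouring n odd (n≤1+n n)) renaming (proj₁ to κ; proj₂ to proper)

  even-case : n % 2 ≡ 0 → DistChromaticNumber (complete n ◇ H) 2 (n * (h + 1) ∸ h)
  even-case even = subst (DistChromaticNumber (complete n ◇ H) 2) (sym (even-count m h))
    (CoronaUpperBound.distColouring (complete n) H κ proper ,
     λ c f sep → CompleteCoronaLowerBound.lower-bound H f sep)
    where open Σ (completeEdgeColouring m (%-pred-≡0 {m} even) ≤-refl) renaming (proj₁ to κ; proj₂ to proper)
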